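{- For each integer $d \geq 1$, there exists a graph $G$ such that $\mathsf{dc}(G) = d$ and $\chi_{ON}(G) > d$.
   Context: A CFON coloring of a graph $G=(V,E)$ with $k$ colors is a map $C: V \to \{1,\dots,k\}$ such that for every $v \in V$ there is a color $i$ with $|N(v)\cap C^{ -1}(i)| = 1$, where $N(v)$ is the open neighborhood of $v$. $\chi_{ON}(G)$ is the minimum $k$ for which a CFON coloring with $k$ colors exists. The distance to cluster $\mathsf{dc}(G)$ is the size of a smallest set $X \subseteq V$ such that $G[V\setminus X]$ is a disjoint union of cliques. -}

module Defs where

open import Data.Nat using (ℕ; _≤_; _<_)
open import Data.Fin using (Fin)
open import Data.Fin.Subset using (Subset; _∈_; _∉_; ∣_∣)
open import Data.Bool using (Bool; true; false)
open import Data.Product using (Σ; ∃; ∃-syntax; _×_; _,_)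
open import Relation.Binary.PropositionalEquality using (_≡_; _≢_)
open import Relation.Nullary using (¬_)

record Graph : Set where
  field
    n       : ℕ
    adj     : Fin n → Fin n → Bool
    sym     : ∀ u v → adj u v ≡ adj v u
    irrefl  : ∀ v → adj v v ≡ false

open Graph public

Adj : (G : Graph) → Fin (n G) → Fin (n G) → Set
Adj G u v = adj G u v ≡ true

IsCFON : (G : Graph) (k : ℕ) → (Fin (n G) → Fin k) → Set
IsCFON G k C = ∀ v → ∃[ i ] ∃[ u ]
  (Adj G v u × C u ≡ i × (∀ w → Adj G v w → C w ≡ i → w ≡ u))

HasCFON : Graph → ℕ → Set
HasCFON G k = Σ (Fin (n G) → Fin k) (IsCFON G k)

-- χ_ON(G) > d : χ_ON(G) is defined (some CFON coloring exists) and
-- no CFON coloring with d colors exists.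
χON> : Graph → ℕ → Set
χON> G d = (∃[ k ] HasCFON G k) × ¬ HasCFON G d

-- G[V ∖ X] is a disjoint union of cliques: adjacency is transitive on
-- distinct vertices outside X (each component of G - X is a clique).
IsCluster-after : (G : Graph) → Subset (n G) → Set
IsCluster-after G X = ∀ u v w → u ∉ X → v ∉ X → w ∉ X →
  Adj G u v → Adj G v w → u ≢ w → Adj G u w

dc≡ : Graph → ℕ → Set
dc≡ G d = (∃[ X ] (∣ X ∣ ≡ d × IsCluster-after G X))
        × (∀ X → IsCluster-after G X → d ≤ ∣ X ∣)

-- The graph has hubs x₁ … x_d; for every pair (a, b) a vertex adjacent exactly to x_a and x_b;
-- and a clique of vertices q(S, t) for S ⊆ [d] and t ∈ [d+1], with q(S, t) adjacent to x_i
-- for i ∈ S. Deleting the hubs leaves isolated vertices and one clique, while the vertex-disjoint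
-- induced paths q(∅, i) – q({i}, i) – x_i show that d deletions are needed.
-- In a conflict-free colouring with d colours the pair vertices force distinct colours on the
-- hubs, so every colour occurs on exactly one hub. Let S₀ be the set of hubs whose colour also
-- occurs on the clique. Two of the d+1 vertices q(S₀, t) share a colour, and at one of them every
-- colour of its neighbourhood occurs twice: once on the clique and once on a hub in S₀.

module Submission where

open import Defs hiding (sym)
open import Data.Bool using (Bool; true; false; not; _∨_)
open import Data.Bool.Properties using (∨-zeroʳ)
import Data.Bool.Properties as Bool
open import Data.Empty using (⊥-elim) renaming (⊥ to Empty)
open import Data.Fin using (Fin; zero; suc; _↑ˡ_; punchOut)
open import Data.Fin.Properties
  using ( _≟_; suc-injective; +↔⊎; *↔×; 2↔Bool; any?; pigeonhole; injective⇒≤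
        ; punchOut-injective; <⇒≢)
open import Data.Fin.Subset using (Subset; _∈_; _∉_; ∣_∣; ⊤; ⊥; ⁅_⁆; inside; outside)
open import Data.Fin.Subset.Properties using (_∈?_; ∉⊥; ∣⊥∣≡0; x∈⁅x⁆; anySubset?)
open import Data.Maybe using (Maybe; just; nothing)
open import Data.Maybe.Properties using (just-injective)
open import Data.Nat using (ℕ; zero; suc; _+_; _*_; _^_; _≤_)
open import Data.Nat.Properties using (n<1+n; 1+n≰n)
open import Data.Product using (∃-syntax; _×_; _,_; proj₁; proj₂; uncurry)
open import Data.Product.Function.NonDependent.Propositional using (_×-↔_)
import Data.Product.Properties as Product
open import Data.Sum using (_⊎_; inj₁; inj₂)
open import Data.Sum.Function.Propositional using (_⊎-↔_)
open import Data.Sum.Properties using (inj₁-injective; inj₂-injective)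
import Data.Sum.Properties as Sum
open import Data.Unit using (tt) renaming (⊤ to Unit)
open import Data.Vec using ([]; _∷_; here; there; _++_; lookup; tabulate)
open import Data.Vec.Properties
  using (lookup∘tabulate; lookup-replicate; []=⇒lookup; lookup⇒[]=; lookup-++ˡ)
import Data.Vec.Properties as Vec
open import Function using (_∘_)
open import Function.Bundles using (_↔_; Inverse; mk↔ₛ′; mk⇔)
open import Function.Definitions using (Injective)
open import Function.Properties.Inverse using (↔-refl; ↔-trans)
open import Relation.Binary.Definitions using (DecidableEquality)
open import Relation.Binary.PropositionalEquality
  using (_≡_; _≢_; refl; sym; trans; cong; cong₂; subst)
open import Relation.Nullary using (¬_; Dec; yes; no; does; proof; contradiction)
open import Relation.Nullary.Decidable using (dec-true; dec-false; does-⇔)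
open import Relation.Nullary.Reflects using (Reflects; invert)

injective⇒surjective : ∀ {n} {f : Fin n → Fin n} → Injective _≡_ _≡_ f → ∀ k → ∃[ i ] f i ≡ k
injective⇒surjective {suc n} {f} f-inj k with any? (λ i → f i ≟ k)
... | yes hit = hit
... | no miss = contradiction (injective⇒≤ punchOut∘f-injective) 1+n≰n
  where
  f≢k : ∀ i → f i ≢ k
  f≢k i fi≡k = miss (i , fi≡k)

  punchOut∘f-injective : Injective _≡_ _≡_ (λ i → punchOut (f≢k i ∘ sym))
  punchOut∘f-injective eq = f-inj (punchOut-injective (f≢k _ ∘ sym) (f≢k _ ∘ sym) eq)

rank : ∀ {n} {x : Fin n} (X : Subset n) → x ∈ X → Fin ∣ X ∣
rank (inside ∷ X)  here        = zero
rank (inside ∷ X)  (there x∈X) = suc (rank X x∈X)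
rank (outside ∷ X) (there x∈X) = rank X x∈X

rank-injective : ∀ {n} {x y : Fin n} (X : Subset n) (x∈X : x ∈ X) (y∈X : y ∈ X) →
                 rank X x∈X ≡ rank X y∈X → x ≡ y
rank-injective (inside ∷ X)  here        here        _  = refl
rank-injective (inside ∷ X)  (there x∈X) (there y∈X) eq =
  cong suc (rank-injective X x∈X y∈X (suc-injective eq))
rank-injective (outside ∷ X) (there x∈X) (there y∈X) eq = cong suc (rank-injective X x∈X y∈X eq)

injective⇒≤∣∣ : ∀ {m n} {X : Subset n} (f : Fin m → Fin n) →
                Injective _≡_ _≡_ f → (∀ i → f i ∈ X) → m ≤ ∣ X ∣
injective⇒≤∣∣ {X = X} f f-inj f∈X =
  injective⇒≤ (λ {i} {j} eq → f-inj (rank-injective X (f∈X i) (f∈X j) eq))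

∣⊤++⊥∣≡ : ∀ m n → ∣ ⊤ {m} ++ ⊥ {n} ∣ ≡ m
∣⊤++⊥∣≡ zero    n = ∣⊥∣≡0 n
∣⊤++⊥∣≡ (suc m) n = cong suc (∣⊤++⊥∣≡ m n)

↑ˡ∈⊤++⊥ : ∀ {m} n (i : Fin m) → i ↑ˡ n ∈ ⊤ {m} ++ ⊥ {n}
↑ˡ∈⊤++⊥ n i = lookup⇒[]= _ _ (trans (lookup-++ˡ ⊤ ⊥ i) (lookup-replicate i inside))

subsets : ∀ {n} → Fin (2 ^ n) ↔ Subset n
subsets {zero}  = mk↔ₛ′ (λ _ → []) (λ _ → zero) (λ { [] → refl }) (λ { zero → refl })
subsets {suc n} = ↔-trans *↔× (↔-trans (2↔Bool ×-↔ subsets) cons↔)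
  where
  cons↔ : (Bool × Subset n) ↔ Subset (suc n)
  cons↔ = mk↔ₛ′ (uncurry _∷_) (λ { (b ∷ S) → b , S }) (λ { (b ∷ S) → refl }) (λ { (b , S) → refl })

module _ {V C : Set} (E : V → V → Bool) (c : V → C) where

  -- With E = adj G, ConflictFree E c unfolds to IsCFON G k c.
  ConflictFreeAt : V → Set
  ConflictFreeAt v = ∃[ i ] ∃[ u ]
    (E v u ≡ true × c u ≡ i × (∀ w → E v w ≡ true → c w ≡ i → w ≡ u))

  ConflictFree : Set
  ConflictFree = ∀ v → ConflictFreeAt v

  two-neighbours-same-colour⇒≡ : ∀ {v a b} → ConflictFreeAt v →
    (∀ w → E v w ≡ true → w ≡ a ⊎ w ≡ b) → E v a ≡ true → E v b ≡ true → c a ≡ c b → a ≡ b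
  two-neighbours-same-colour⇒≡ (i , u , vu , cu , unique) N⊆ab va vb ca≡cb with N⊆ab u vu
  ... | inj₁ refl = sym (unique _ vb (trans (sym ca≡cb) cu))
  ... | inj₂ refl = unique _ va (trans ca≡cb cu)

  colours-repeated⇒¬ConflictFreeAt : ∀ {v} →
    (∀ u → E v u ≡ true → ∃[ w ] (E v w ≡ true × c w ≡ c u × w ≢ u)) → ¬ ConflictFreeAt v
  colours-repeated⇒¬ConflictFreeAt repeated (i , u , vu , cu , unique) with repeated u vu
  ... | w , vw , cw≡cu , w≢u = w≢u (unique w vw (trans cw≡cu cu))

no-isolated⇒ConflictFree-id : ∀ {V : Set} (E : V → V → Bool) →
  (∀ v → ∃[ u ] E v u ≡ true) → ConflictFree E (λ v → v)
no-isolated⇒ConflictFree-id E neighbour v =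
  proj₁ (neighbour v) , proj₁ (neighbour v) , proj₂ (neighbour v) , refl , λ _ _ w≡u → w≡u

record InducedP₃ (G : Graph) (a b c : Fin (n G)) : Set where
  field
    a~b : Adj G a b
    b~c : Adj G b c
    a≢c : a ≢ c
    a≁c : ¬ Adj G a c

P₃-hits : ∀ {G X a b c} → IsCluster-after G X → InducedP₃ G a b c → a ∈ X ⊎ b ∈ X ⊎ c ∈ X
P₃-hits {X = X} {a} {b} {c} cluster P with a ∈? X | b ∈? X | c ∈? X
... | yes a∈X | _       | _       = inj₁ a∈X
... | no _    | yes b∈X | _       = inj₂ (inj₁ b∈X)
... | no _    | no _    | yes c∈X = inj₂ (inj₂ c∈X)
... | no a∉X  | no b∉X  | no c∉X  =
  ⊥-elim (a≁c (cluster a b c a∉X b∉X c∉X a~b b~c a≢c))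
  where open InducedP₃ P

-- The owner map witnesses that the paths are vertex-disjoint.
disjoint-P₃s⇒≤∣X∣ : ∀ {G m} (owner : Fin (n G) → Maybe (Fin m)) (a b c : Fin m → Fin (n G)) →
  (∀ i → InducedP₃ G (a i) (b i) (c i)) →
  (∀ i → owner (a i) ≡ just i) → (∀ i → owner (b i) ≡ just i) → (∀ i → owner (c i) ≡ just i) →
  ∀ X → IsCluster-after G X → m ≤ ∣ X ∣
disjoint-P₃s⇒≤∣X∣ {G} {m} owner a b c P owns-a owns-b owns-c X cluster =
  injective⇒≤∣∣ pick pick-injective (proj₁ ∘ proj₂ ∘ hit)
  where
  hit : ∀ i → ∃[ u ] (u ∈ X × owner u ≡ just i)
  hit i with P₃-hits cluster (P i)
  ... | inj₁ a∈X        = a i , a∈X , owns-a i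
  ... | inj₂ (inj₁ b∈X) = b i , b∈X , owns-b i
  ... | inj₂ (inj₂ c∈X) = c i , c∈X , owns-c i

  pick : Fin m → Fin (n G)
  pick = proj₁ ∘ hit

  owner-pick : ∀ i → owner (pick i) ≡ just i
  owner-pick = proj₂ ∘ proj₂ ∘ hit

  pick-injective : Injective _≡_ _≡_ pick
  pick-injective eq = just-injective (trans (sym (owner-pick _)) (trans (cong owner eq) (owner-pick _)))

module Enumerated {V : Set} {N : ℕ} (enum : Fin N ↔ V) (E : V → V → Bool)
                  (E-sym : ∀ u v → E u v ≡ E v u) (E-irrefl : ∀ v → E v v ≡ false) where

  open Inverse enum using (to; from; strictlyInverseˡ; strictlyInverseʳ)

  graph : Graph
  graph = record
    { n      = N
    ; adj    = λ u v → E (to u) (to v)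
    ; sym    = λ u v → E-sym (to u) (to v)
    ; irrefl = λ v → E-irrefl (to v)
    }

  adj-from : ∀ a b → adj graph (from a) (from b) ≡ E a b
  adj-from a b = cong₂ E (strictlyInverseˡ a) (strictlyInverseˡ b)

  ConflictFree-from : ∀ {C} {c : Fin N → C} →
                      ConflictFree (adj graph) c → ConflictFree E (c ∘ from)
  ConflictFree-from {c = c} cf v with cf (from v)
  ... | i , u , vu , cu , unique = i , to u , vu′ , cu′ , unique′
    where
    vu′ : E v (to u) ≡ true
    vu′ = subst (λ z → E z (to u) ≡ true) (strictlyInverseˡ v) vu
    cu′ : c (from (to u)) ≡ i
    cu′ = trans (cong c (strictlyInverseʳ u)) cu
    unique′ : ∀ w → E v w ≡ true → c (from w) ≡ i → w ≡ to u
    unique′ w vw cw = trans (sym (strictlyInverseˡ w))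
                            (cong to (unique (from w) (trans (adj-from v w) vw) cw))

  no-isolated-from : (∀ v → ∃[ w ] E v w ≡ true) → ∀ u → ∃[ w ] Adj graph u w
  no-isolated-from neighbour u with neighbour (to u)
  ... | w , uw = from w , trans (cong (E (to u)) (strictlyInverseˡ w)) uw

  InducedP₃-from : ∀ {a b c} → E a b ≡ true → E b c ≡ true → a ≢ c → E a c ≡ false →
                   InducedP₃ graph (from a) (from b) (from c)
  InducedP₃-from {a} {b} {c} ab bc a≢c ac = record
    { a~b = trans (adj-from a b) ab
    ; b~c = trans (adj-from b c) bc
    ; a≢c = λ eq → a≢c (trans (sym (strictlyInverseˡ a)) (trans (cong to eq) (strictlyInverseˡ c)))
    ; a≁c = λ a~c → contradiction (trans (sym a~c) (trans (adj-from a c) ac)) λ ()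
    }

Vertex : ℕ → Set
Vertex d = Fin d ⊎ (Fin d × Fin d) ⊎ (Subset d × Fin (suc d))

pattern hub i      = inj₁ i
pattern pair a b   = inj₂ (inj₁ (a , b))
pattern clique S t = inj₂ (inj₂ (S , t))

enumerate : ∀ d → Fin (d + (d * d + 2 ^ d * suc d)) ↔ Vertex d
enumerate d = ↔-trans +↔⊎ (↔-refl ⊎-↔ ↔-trans +↔⊎ (*↔× ⊎-↔ ↔-trans *↔× (subsets ×-↔ ↔-refl)))

module _ {d : ℕ} where

  _≟ᵛ_ : DecidableEquality (Vertex d)
  _≟ᵛ_ = Sum.≡-dec _≟_ (Sum.≡-dec (Product.≡-dec _≟_ _≟_) (Product.≡-dec (Vec.≡-dec Bool._≟_) _≟_))

  infix 5 _~_
  _~_ : Vertex d → Vertex d → Bool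
  hub i      ~ pair a b   = does (i ≟ a) ∨ does (i ≟ b)
  hub i      ~ clique S t = lookup S i
  pair a b   ~ hub i      = hub i ~ pair a b
  clique S t ~ hub i      = hub i ~ clique S t
  u@(clique _ _) ~ w@(clique _ _) = not (does (u ≟ᵛ w))
  _ ~ _ = false

  ~-sym : ∀ u w → u ~ w ≡ w ~ u
  ~-sym (hub _)      (hub _)      = refl
  ~-sym (hub _)      (pair _ _)   = refl
  ~-sym (hub _)      (clique _ _) = refl
  ~-sym (pair _ _)   (hub _)      = refl
  ~-sym (pair _ _)   (pair _ _)   = refl
  ~-sym (pair _ _)   (clique _ _) = refl
  ~-sym (clique _ _) (hub _)      = refl
  ~-sym (clique _ _) (pair _ _)   = refl
  ~-sym u@(clique _ _) w@(clique _ _) = cong not (does-⇔ (mk⇔ sym sym) (u ≟ᵛ w) (w ≟ᵛ u))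

  ~-irrefl : ∀ u → u ~ u ≡ false
  ~-irrefl (hub _)        = refl
  ~-irrefl (pair _ _)     = refl
  ~-irrefl u@(clique _ _) = cong not (dec-true (u ≟ᵛ u) refl)

  clique-adjacent : ∀ {S t S′ t′} → clique S t ≢ clique S′ t′ → clique S t ~ clique S′ t′ ≡ true
  clique-adjacent {S} {t} {S′} {t′} ≢ = cong not (dec-false (clique S t ≟ᵛ clique S′ t′) ≢)

  pair~hubˡ : ∀ a b → pair a b ~ hub a ≡ true
  pair~hubˡ a b = cong (_∨ does (a ≟ b)) (dec-true (a ≟ a) refl)

  pair~hubʳ : ∀ a b → pair a b ~ hub b ≡ true
  pair~hubʳ a b = trans (cong (does (b ≟ a) ∨_) (dec-true (b ≟ b) refl)) (∨-zeroʳ _)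

  pair-neighbours : ∀ {a b} w → pair a b ~ w ≡ true → w ≡ hub a ⊎ w ≡ hub b
  pair-neighbours {a} {b} (hub i) adj with i ≟ a | i ≟ b
  ... | yes refl | _        = inj₁ refl
  ... | no _     | yes refl = inj₂ refl
  pair-neighbours (hub i) () | no _ | no _

every-vertex-has-a-neighbour : ∀ {d} (v : Vertex (suc d)) → ∃[ w ] v ~ w ≡ true
every-vertex-has-a-neighbour (hub i)           = pair i i , pair~hubˡ i i
every-vertex-has-a-neighbour (pair a b)        = hub a , pair~hubˡ a b
every-vertex-has-a-neighbour (clique S zero)    = clique S (suc zero) , clique-adjacent {S = S} λ ()
every-vertex-has-a-neighbour (clique S (suc t)) = clique S zero , clique-adjacent {S = S} λ ()

module DColouring {d : ℕ} (c : Vertex d → Fin d) (cf : ConflictFree _~_ c) where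

  hub-colour-injective : Injective _≡_ _≡_ (c ∘ hub)
  hub-colour-injective {i} {j} same = inj₁-injective
    (two-neighbours-same-colour⇒≡ _~_ c {v = pair i j} (cf (pair i j))
      pair-neighbours (pair~hubˡ i j) (pair~hubʳ i j) same)

  UsedOnClique : Fin d → Set
  UsedOnClique k = ∃[ S ] ∃[ t ] c (clique S t) ≡ k

  usedOnClique? : ∀ k → Dec (UsedOnClique k)
  usedOnClique? k = anySubset? (λ S → any? (λ t → c (clique S t) ≟ k))

  S₀ : Subset d
  S₀ = tabulate (λ i → does (usedOnClique? (c (hub i))))

  S₀-lookup : ∀ i → lookup S₀ i ≡ does (usedOnClique? (c (hub i)))
  S₀-lookup i = lookup∘tabulate _ i

  S₀-lookup⇒used : ∀ {i} → lookup S₀ i ≡ true → UsedOnClique (c (hub i))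
  S₀-lookup⇒used {i} i∈S₀ =
    invert (subst (Reflects _) (trans (sym (S₀-lookup i)) i∈S₀) (proof (usedOnClique? _)))

  used⇒hub-in-S₀ : ∀ {k} → UsedOnClique k → ∃[ i ] (lookup S₀ i ≡ true × c (hub i) ≡ k)
  used⇒hub-in-S₀ {k} used with injective⇒surjective hub-colour-injective k
  ... | i , ci≡k =
    i , trans (S₀-lookup i) (dec-true (usedOnClique? _) (subst UsedOnClique (sym ci≡k) used)) , ci≡k

  module _ {t₁ t₂} (t₁≢t₂ : t₁ ≢ t₂) (same : c (clique S₀ t₁) ≡ c (clique S₀ t₂)) where

    used⇒clique-neighbour : ∀ {k} → UsedOnClique k →
                            ∃[ S ] ∃[ t ] (clique S₀ t₁ ~ clique S t ≡ true × c (clique S t) ≡ k)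
    used⇒clique-neighbour (S , t , ck) with clique S t ≟ᵛ clique S₀ t₁
    ... | no ≢    = S , t , clique-adjacent (≢ ∘ sym) , ck
    ... | yes refl =
      S₀ , t₂ , clique-adjacent {S = S₀} {t₁} {S₀} {t₂} (λ { refl → t₁≢t₂ refl }) ,
      trans (sym same) ck

    colours-repeated : ∀ u → clique S₀ t₁ ~ u ≡ true →
                       ∃[ w ] (clique S₀ t₁ ~ w ≡ true × c w ≡ c u × w ≢ u)
    colours-repeated (hub i) adj with used⇒clique-neighbour (S₀-lookup⇒used adj)
    ... | S , t , adj′ , cS = clique S t , adj′ , cS , λ ()
    colours-repeated (clique S t) adj with used⇒hub-in-S₀ (S , t , refl)
    ... | i , adj′ , ci = hub i , adj′ , ci , λ ()

  S₀-colour-clash : ∃[ t₁ ] ∃[ t₂ ] (t₁ ≢ t₂ × c (clique S₀ t₁) ≡ c (clique S₀ t₂))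
  S₀-colour-clash with pigeonhole (n<1+n d) (λ t → c (clique S₀ t))
  ... | t₁ , t₂ , t₁<t₂ , same = t₁ , t₂ , <⇒≢ t₁<t₂ , same

¬ConflictFree-with-d-colours : ∀ {d} (c : Vertex d → Fin d) → ¬ ConflictFree _~_ c
¬ConflictFree-with-d-colours c cf =
  let t₁ , t₂ , t₁≢t₂ , same = S₀-colour-clash in
  colours-repeated⇒¬ConflictFreeAt _~_ c {v = clique S₀ t₁}
    (colours-repeated t₁≢t₂ same) (cf (clique S₀ t₁))
  where open DColouring c cf

NonHub : ∀ {d} → Vertex d → Set
NonHub (hub _) = Empty
NonHub _       = Unit

non-hubs-cluster : ∀ {d} {u v w : Vertex d} → NonHub u → NonHub v → NonHub w →
                   u ~ v ≡ true → v ~ w ≡ true → u ≢ w → u ~ w ≡ true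
non-hubs-cluster {u = clique _ _} {clique _ _} {clique _ _} _ _ _ _ _ u≢w = clique-adjacent u≢w
non-hubs-cluster {u = pair _ _} {clique _ _} _ _ _ ()
non-hubs-cluster {u = clique _ _} {pair _ _} _ _ _ ()
non-hubs-cluster {u = pair _ _} {pair _ _} _ _ _ ()
non-hubs-cluster {v = clique _ _} {pair _ _} _ _ _ _ ()

owner : ∀ {d} → Vertex d → Maybe (Fin d)
owner (hub i)            = just i
owner (clique _ (suc i)) = just i
owner _                  = nothing

module Construction (d : ℕ) where

  open Enumerated (enumerate d) _~_ ~-sym ~-irrefl public
  open Inverse (enumerate d) using (to; from; strictlyInverseˡ; strictlyInverseʳ)

  -- enumerate places the hubs first.
  hubs : Subset (n graph)
  hubs = ⊤ {d} ++ ⊥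

  ∣hubs∣ : ∣ hubs ∣ ≡ d
  ∣hubs∣ = ∣⊤++⊥∣≡ d _

  ∉hubs⇒NonHub : ∀ u → u ∉ hubs → NonHub (to u)
  ∉hubs⇒NonHub u u∉hubs with to u in eq
  ... | hub i      =
    u∉hubs (subst (_∈ hubs) (trans (cong from (sym eq)) (strictlyInverseʳ u)) (↑ˡ∈⊤++⊥ _ i))
  ... | pair _ _   = tt
  ... | clique _ _ = tt

  hubs-cluster : IsCluster-after graph hubs
  hubs-cluster u v w u∉ v∉ w∉ uv vw u≢w =
    non-hubs-cluster (∉hubs⇒NonHub u u∉) (∉hubs⇒NonHub v v∉) (∉hubs⇒NonHub w w∉) uv vw
      (λ eq → u≢w (trans (sym (strictlyInverseʳ u)) (trans (cong from eq) (strictlyInverseʳ w))))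

  cluster-deletion-set-≥ : ∀ X → IsCluster-after graph X → d ≤ ∣ X ∣
  cluster-deletion-set-≥ =
    disjoint-P₃s⇒≤∣X∣ (owner ∘ to) (from ∘ start) (from ∘ middle) (from ∘ hub) path
      (owner-to-from ∘ start) (owner-to-from ∘ middle) (owner-to-from ∘ hub)
    where
    start middle : Fin d → Vertex d
    start  i = clique ⊥ (suc i)
    middle i = clique ⁅ i ⁆ (suc i)

    start≢middle : ∀ i → start i ≢ middle i
    start≢middle i eq =
      ∉⊥ (subst (i ∈_) (sym (Product.,-injectiveˡ (inj₂-injective (inj₂-injective eq)))) (x∈⁅x⁆ i))

    path : ∀ i → InducedP₃ graph (from (start i)) (from (middle i)) (from (hub i))
    path i = InducedP₃-from {start i} {middle i} {hub i}
      (clique-adjacent (start≢middle i)) ([]=⇒lookup (x∈⁅x⁆ i)) (λ ()) (lookup-replicate i outside)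

    owner-to-from : ∀ v → owner (to (from v)) ≡ owner v
    owner-to-from v = cong owner (strictlyInverseˡ v)

  ¬HasCFON : ¬ HasCFON graph d
  ¬HasCFON (c , cf) = ¬ConflictFree-with-d-colours (c ∘ from) (ConflictFree-from cf)

theorem2 : ∀ (d : ℕ) → 1 ≤ d → ∃[ G ] (dc≡ G d × χON> G d)
theorem2 (suc d) _ =
  graph , ((hubs , ∣hubs∣ , hubs-cluster) , cluster-deletion-set-≥)
        , ((n graph , (λ u → u) , no-isolated⇒ConflictFree-id (adj graph) no-isolated) , ¬HasCFON)
  where
  open Construction (suc d)

  no-isolated : ∀ u → ∃[ w ] Adj graph u w
  no-isolated = no-isolated-from every-vertex-has-a-neighbour
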